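{- Let $L \in \mathbb{Q} \setminus \{0,1\}$. If $L^2 - L + 1$ is the square of a rational number, then $L^2 - L$ is not the square of a rational number. -}

module Defs where

module Submission where

-- With m/n = |2L − 1| the hypotheses say that
-- m² − n² = u² and m² + 3n² = v² (these are 4n² times L² − L and L² − L + 1),
-- and L ∉ {0, 1} makes u nonzero.  No such m, n exist, by descent on m.  A prime
-- dividing m and n divides the whole solution.  For coprime m, n the two factors
-- (m² + n² ∓ uv)/2 of (m² + n²)² − (uv)² = 4n⁴ are coprime, hence fourth powers
-- a⁴, b⁴ with n = ab and m² = a⁴ − a²b² + b⁴.  According to the parities of a
-- and b this quartic becomes w² = p⁴ − 4p²c² + 16c⁴ (b = 2c) or, via a = k + l
-- and b = k − l, m² = k⁴ + 14k²l² + l⁴, that is m² = o⁴ + 56o²c² + 16c⁴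
-- (l = 2c).  Each of these is again a difference of two squares, and its
-- coprime factors either give a smaller solution or are impossible modulo 3 or
-- modulo 4.

module Descent where

  open import Data.Empty using (⊥; ⊥-elim)
  open import Data.List.Base using ([]; _∷_)
  import Data.List.Relation.Unary.All as All
  open import Data.Nat.Base
  open import Data.Nat.Coprimality using (Coprime; coprime-divisor; gcd≡1⇒coprime) renaming (sym to coprime-sym)
  open import Data.Nat.Divisibility
  open import Data.Nat.GCD using (gcd; gcd[m,n]∣m; gcd[m,n]∣n)
  open import Data.Nat.Induction using (<-rec)
  open import Data.Nat.ListAction using (product)
  open import Data.Nat.Primality
    using (Prime; prime?; prime[2]; ¬prime[1]; euclidsLemma; prime⇒irreducible; prime⇒nonZero; prime⇒nonTrivial)
  open import Data.Nat.Primality.Factorisation using (factorise)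
  open import Data.Nat.Properties
  open import Data.Nat.Tactic.RingSolver using (solve)
  open import Data.Product using (∃; ∃₂; _×_; _,_)
  open import Data.Sum using (_⊎_; inj₁; inj₂; [_,_]′)
  open import Function.Base using (case_of_; _∘_)
  open import Relation.Binary.PropositionalEquality
  open import Relation.Nullary using (¬_; yes; no; contradiction)
  open import Relation.Nullary.Decidable using (from-yes)

  m≡n+k⊎n≡m+1+k : ∀ m n → (∃ λ k → m ≡ n + k) ⊎ (∃ λ k → n ≡ m + suc k)
  m≡n+k⊎n≡m+1+k m n with ≤-<-connex n m
  ... | inj₁ n≤m = inj₁ (_ , sym (m+[n∸m]≡n n≤m))
  ... | inj₂ m<n = inj₂ (_ , sym (trans (+-suc m _) (m+[n∸m]≡n m<n)))

  m*m<n*n⇒m<n : ∀ {m n} → m * m < n * n → m < n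
  m*m<n*n⇒m<n {m} {n} mm<nn with <-≤-connex m n
  ... | inj₁ m<n = m<n
  ... | inj₂ n≤m = contradiction mm<nn (≤⇒≯ (*-mono-≤ n≤m n≤m))

  m*m≤n*n⇒m≤n : ∀ {m n} → m * m ≤ n * n → m ≤ n
  m*m≤n*n⇒m≤n {m} {n} mm≤nn with ≤-<-connex m n
  ... | inj₁ m≤n = m≤n
  ... | inj₂ n<m = contradiction mm≤nn (<⇒≱ (*-mono-< n<m n<m))

  m*m≡n*n⇒m≡n : ∀ {m n} → m * m ≡ n * n → m ≡ n
  m*m≡n*n⇒m≡n mm≡nn = ≤-antisym (m*m≤n*n⇒m≤n (≤-reflexive mm≡nn)) (m*m≤n*n⇒m≤n (≤-reflexive (sym mm≡nn)))

  0<m*n⇒0<m : ∀ {m n} → 0 < m * n → 0 < m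
  0<m*n⇒0<m {suc m} _ = z<s

  odd⇒0<m : ∀ {m} → ¬ 2 ∣ m → 0 < m
  odd⇒0<m {0} 2∤0 = contradiction (2 ∣0) 2∤0
  odd⇒0<m {suc m} _ = z<s

  0<r<d⇒d∤r+k*d : ∀ {r d} k → 0 < r → r < d → ¬ d ∣ r + k * d
  0<r<d⇒d∤r+k*d {r} {d} k 0<r r<d d∣r+kd =
    <⇒≱ r<d (∣⇒≤ {{>-nonZero 0<r}} (∣m+n∣m⇒∣n (subst (d ∣_) (+-comm r (k * d)) d∣r+kd) (n∣m*n k)))

  even⊎odd : ∀ n → ∃ λ k → n ≡ 2 * k ⊎ n ≡ 1 + 2 * k
  even⊎odd 0 = 0 , inj₁ refl
  even⊎odd (suc n) with even⊎odd n
  ... | k , inj₁ refl = k , inj₂ refl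
  ... | k , inj₂ refl = suc k , inj₁ (solve (k ∷ []))

  odd+odd⇒even : ∀ {m n} → ¬ 2 ∣ m → ¬ 2 ∣ n → 2 ∣ m + n
  odd+odd⇒even {m} {n} 2∤m 2∤n with even⊎odd m | even⊎odd n
  ... | i , inj₁ refl | _ = contradiction (divides i (*-comm 2 i)) 2∤m
  ... | _ | j , inj₁ refl = contradiction (divides j (*-comm 2 j)) 2∤n
  ... | i , inj₂ refl | j , inj₂ refl = divides (1 + i + j) (solve (i ∷ j ∷ []))

  odd-square : ∀ {n} → ¬ 2 ∣ n → ∃ λ k → n * n ≡ 1 + 4 * k
  odd-square {n} 2∤n with even⊎odd n
  ... | k , inj₁ refl = contradiction (divides k (*-comm 2 k)) 2∤n
  ... | k , inj₂ refl = k * k + k , solve (k ∷ [])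

  1+4a≢3+4b : ∀ a b → 1 + 4 * a ≢ 3 + 4 * b
  1+4a≢3+4b a b eq = 0<r<d⇒d∤r+k*d {2} {4} b z<s (s<s (s<s z<s)) (divides a (begin
    2 + b * 4  ≡⟨ cong (2 +_) (*-comm b 4) ⟩
    2 + 4 * b  ≡⟨ suc-injective eq ⟨
    4 * a      ≡⟨ *-comm 4 a ⟩
    a * 4      ∎))
    where open ≡-Reasoning

  residue-mod-3 : ∀ n → ∃ λ k → n ≡ 3 * k ⊎ n ≡ 1 + 3 * k ⊎ n ≡ 2 + 3 * k
  residue-mod-3 0 = 0 , inj₁ refl
  residue-mod-3 (suc n) with residue-mod-3 n
  ... | k , inj₁ refl = k , inj₂ (inj₁ refl)
  ... | k , inj₂ (inj₁ refl) = k , inj₂ (inj₂ refl)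
  ... | k , inj₂ (inj₂ refl) = suc k , inj₁ (solve (k ∷ []))

  3∤⇒square≡1+3k : ∀ {n} → ¬ 3 ∣ n → ∃ λ k → n * n ≡ 1 + 3 * k
  3∤⇒square≡1+3k {n} 3∤n with residue-mod-3 n
  ... | k , inj₁ refl = contradiction (divides k (*-comm 3 k)) 3∤n
  ... | k , inj₂ (inj₁ refl) = 3 * k * k + 2 * k , solve (k ∷ [])
  ... | k , inj₂ (inj₂ refl) = 3 * k * k + 4 * k + 1 , solve (k ∷ [])

  3∣m*m+n*n⇒3∣m : ∀ m n → 3 ∣ m * m + n * n → 3 ∣ m
  3∣m*m+n*n⇒3∣m m n 3∣sum with 3 ∣? m | 3 ∣? n
  ... | yes 3∣m | _ = 3∣m
  ... | no 3∤m | yes (divides j refl) with 3∤⇒square≡1+3k 3∤m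
  ...   | i , mm≡1+3i = contradiction (subst (3 ∣_) sum≡ 3∣sum) (0<r<d⇒d∤r+k*d {1} {3} (i + 3 * (j * j)) z<s (s<s z<s))
    where
    open ≡-Reasoning
    sum≡ : m * m + j * 3 * (j * 3) ≡ 1 + (i + 3 * (j * j)) * 3
    sum≡ = begin
      m * m + j * 3 * (j * 3)      ≡⟨ cong (_+ j * 3 * (j * 3)) mm≡1+3i ⟩
      1 + 3 * i + j * 3 * (j * 3)  ≡⟨ solve (i ∷ j ∷ []) ⟩
      1 + (i + 3 * (j * j)) * 3    ∎
  3∣m*m+n*n⇒3∣m m n 3∣sum | no 3∤m | no 3∤n with 3∤⇒square≡1+3k 3∤m | 3∤⇒square≡1+3k 3∤n
  ... | i , mm≡1+3i | j , nn≡1+3j =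
    contradiction (subst (3 ∣_) sum≡ 3∣sum) (0<r<d⇒d∤r+k*d {2} {3} (i + j) z<s (s<s (s<s z<s)))
    where
    open ≡-Reasoning
    sum≡ : m * m + n * n ≡ 2 + (i + j) * 3
    sum≡ = begin
      m * m + n * n                ≡⟨ cong₂ _+_ mm≡1+3i nn≡1+3j ⟩
      1 + 3 * i + (1 + 3 * j)      ≡⟨ solve (i ∷ j ∷ []) ⟩
      2 + (i + j) * 3              ∎

  prime[3] : Prime 3
  prime[3] = from-yes (prime? 3)

  prime∣m*m⇒prime∣m : ∀ {p m} → Prime p → p ∣ m * m → p ∣ m
  prime∣m*m⇒prime∣m {m = m} pp p∣mm with euclidsLemma m m pp p∣mm
  ... | inj₁ p∣m = p∣m
  ... | inj₂ p∣m = p∣m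

  prime∣m⁴⇒prime∣m : ∀ {p m} → Prime p → p ∣ m * m * (m * m) → p ∣ m
  prime∣m⁴⇒prime∣m pp p∣m⁴ = prime∣m*m⇒prime∣m pp (prime∣m*m⇒prime∣m pp p∣m⁴)

  prime∣m^k⇒prime∣m : ∀ {p m} k → Prime p → p ∣ m ^ k → p ∣ m
  prime∣m^k⇒prime∣m 0 pp p∣1 = contradiction (subst Prime (∣1⇒≡1 p∣1) pp) ¬prime[1]
  prime∣m^k⇒prime∣m {m = m} (suc k) pp p∣m^1+k with euclidsLemma m (m ^ k) pp p∣m^1+k
  ... | inj₁ p∣m = p∣m
  ... | inj₂ p∣m^k = prime∣m^k⇒prime∣m k pp p∣m^k

  prime∣prime⇒≡ : ∀ {p q} → Prime p → Prime q → p ∣ q → p ≡ q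
  prime∣prime⇒≡ pp pq p∣q with prime⇒irreducible pq p∣q
  ... | inj₁ refl = contradiction pp ¬prime[1]
  ... | inj₂ p≡q = p≡q

  prime∣4*n : ∀ {p n} → Prime p → p ∣ 4 * n → p ≡ 2 ⊎ p ∣ n
  prime∣4*n {n = n} pp p∣4n with euclidsLemma 4 n pp p∣4n
  ... | inj₁ p∣4 = inj₁ (prime∣prime⇒≡ pp prime[2] (prime∣m^k⇒prime∣m 2 pp p∣4))
  ... | inj₂ p∣n = inj₂ p∣n

  prime-square∤ : ∀ {p n} → Prime p → 0 < n → n < 4 → ¬ p * p ∣ n
  prime-square∤ {p} pp 0<n n<4 pp∣n = <⇒≱ (<-≤-trans n<4 (*-mono-≤ 2≤p 2≤p)) (∣⇒≤ {{>-nonZero 0<n}} pp∣n)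
    where
    2≤p : 2 ≤ p
    2≤p = nonTrivial⇒n>1 p {{prime⇒nonTrivial pp}}

  prime-divisor : ∀ n → n ≢ 1 → ∃ λ p → Prime p × p ∣ n
  prime-divisor 0 _ = 2 , prime[2] , 2 ∣0
  prime-divisor 1 1≢1 = contradiction refl 1≢1
  prime-divisor n@(2+ _) _ with factorise n
  ... | record { factors = p ∷ ps ; isFactorisation = n≡p*ps ; factorsPrime = pp All.∷ _ } =
    p , pp , divides (product ps) (trans n≡p*ps (*-comm p (product ps)))

  coprime⊎common-prime : ∀ m n → Coprime m n ⊎ ∃ λ p → Prime p × p ∣ m × p ∣ n
  coprime⊎common-prime m n with gcd m n ≟ 1
  ... | yes g≡1 = inj₁ (gcd≡1⇒coprime g≡1)
  ... | no g≢1 with prime-divisor (gcd m n) g≢1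
  ...   | p , pp , p∣g = inj₂ (p , pp , ∣-trans p∣g (gcd[m,n]∣m m n) , ∣-trans p∣g (gcd[m,n]∣n m n))

  ¬common-prime⇒coprime : ∀ {m n} → (∀ {p} → Prime p → p ∣ m → p ∣ n → ⊥) → Coprime m n
  ¬common-prime⇒coprime {m} {n} ¬common with coprime⊎common-prime m n
  ... | inj₁ coprime = coprime
  ... | inj₂ (p , pp , p∣m , p∣n) = ⊥-elim (¬common pp p∣m p∣n)

  coprime⇒¬common-prime : ∀ {m n p} → Coprime m n → Prime p → p ∣ m → p ∣ n → ⊥
  coprime⇒¬common-prime coprime pp p∣m p∣n = ¬prime[1] (subst Prime (coprime (p∣m , p∣n)) pp)

  coprime-∣ : ∀ {d e m n} → d ∣ m → e ∣ n → Coprime m n → Coprime d e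
  coprime-∣ d∣m e∣n coprime (i∣d , i∣e) = coprime (∣-trans i∣d d∣m , ∣-trans i∣e e∣n)

  prime∤⇒coprime-square : ∀ {p n} → Prime p → ¬ p ∣ n → Coprime (p * p) n
  prime∤⇒coprime-square pp p∤n = ¬common-prime⇒coprime λ pq q∣pp q∣n →
    p∤n (subst (_∣ _) (prime∣prime⇒≡ pq pp (prime∣m*m⇒prime∣m pq q∣pp)) q∣n)

  common-prime-factor∣ : ∀ {p f g c k} → Prime p → p ∣ f → p ∣ g → f * g ≡ c * k → ¬ p * p ∣ c → p ∣ k
  common-prime-factor∣ {p} {c = c} {k} pp p∣f p∣g fg≡ck pp∤c with p ∣? k
  ... | yes p∣k = p∣k
  ... | no p∤k = contradiction (coprime-divisor (prime∤⇒coprime-square pp p∤k) pp∣kc) pp∤c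
    where
    pp∣kc : p * p ∣ k * c
    pp∣kc = subst (p * p ∣_) (trans fg≡ck (*-comm c k)) (*-pres-∣ p∣f p∣g)

  2^j∣m*n⇒2^j∣m : ∀ {m n} j → ¬ 2 ∣ n → 2 ^ j ∣ m * n → 2 ^ j ∣ m
  2^j∣m*n⇒2^j∣m {m} {n} j 2∤n 2^j∣mn = coprime-divisor coprime (subst (2 ^ j ∣_) (*-comm m n) 2^j∣mn)
    where
    coprime : Coprime (2 ^ j) n
    coprime = ¬common-prime⇒coprime λ {r} pr r∣2^j r∣n →
      2∤n (subst (_∣ n) (prime∣prime⇒≡ pr prime[2] (prime∣m^k⇒prime∣m j pr r∣2^j)) r∣n)

  m*m+n*n≡3*k*k⇒3∣m×3∣k : ∀ {m n k} → m * m + n * n ≡ 3 * (k * k) → 3 ∣ m × 3 ∣ k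
  m*m+n*n≡3*k*k⇒3∣m×3∣k {m} {n} {k} eq
    with 3∣m*m+n*n⇒3∣m m n 3∣sum | 3∣m*m+n*n⇒3∣m n m (subst (3 ∣_) (+-comm (m * m) _) 3∣sum)
    where
    3∣sum : 3 ∣ m * m + n * n
    3∣sum = divides (k * k) (trans eq (*-comm 3 (k * k)))
  ... | divides i refl | divides j refl =
    divides i refl , prime∣m*m⇒prime∣m prime[3] (divides (i * i + j * j) (*-cancelˡ-≡ _ _ 3 (begin
      3 * (k * k)                    ≡⟨ eq ⟨
      i * 3 * (i * 3) + j * 3 * (j * 3) ≡⟨ solve (i ∷ j ∷ []) ⟩
      3 * ((i * i + j * j) * 3)      ∎)))
    where open ≡-Reasoning

  prime-square-factor : ∀ {p m n k} → Prime p → p ∣ m → Coprime m n → m * n ≡ k * k →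
                        ∃₂ λ m′ k′ → m ≡ m′ * (p * p) × m′ * n ≡ k′ * k′
  prime-square-factor {p} {m} {n} {k} pp p∣m coprime mn≡kk
    with prime∣m*m⇒prime∣m {m = k} pp (subst (p ∣_) mn≡kk (∣m⇒∣m*n n p∣m))
  ... | divides k′ refl with coprime-divisor (prime∤⇒coprime-square pp p∤n) pp∣nm
    where
    open ≡-Reasoning
    p∤n : ¬ p ∣ n
    p∤n = coprime⇒¬common-prime coprime pp p∣m
    pp∣nm : p * p ∣ n * m
    pp∣nm = divides (k′ * k′) (begin
      n * m              ≡⟨ *-comm n m ⟩
      m * n              ≡⟨ mn≡kk ⟩
      k′ * p * (k′ * p)  ≡⟨ solve (k′ ∷ p ∷ []) ⟩
      k′ * k′ * (p * p)  ∎)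
  ... | divides m′ refl = m′ , k′ , refl , *-cancelʳ-≡ _ _ (p * p) {{m*n≢0 p p {{p≢0}} {{p≢0}}}} (begin
        m′ * n * (p * p)   ≡⟨ solve (m′ ∷ n ∷ p ∷ []) ⟩
        m′ * (p * p) * n   ≡⟨ mn≡kk ⟩
        k′ * p * (k′ * p)  ≡⟨ solve (k′ ∷ p ∷ []) ⟩
        k′ * k′ * (p * p)  ∎)
    where
    open ≡-Reasoning
    p≢0 : NonZero p
    p≢0 = prime⇒nonZero pp

  coprime-product-square : ∀ {m n k} → Coprime m n → m * n ≡ k * k → ∃ λ a → m ≡ a * a
  coprime-product-square {m} {n} {k} = <-rec Goal step m {n} {k}
    where
    Goal : ℕ → Set
    Goal m = ∀ {n k} → Coprime m n → m * n ≡ k * k → ∃ λ a → m ≡ a * a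

    step : ∀ m → (∀ {m′} → m′ < m → Goal m′) → Goal m
    step 0 _ _ _ = 0 , refl
    step 1 _ _ _ = 1 , refl
    step m@(2+ _) rec {n} {k} coprime mn≡kk with prime-divisor m (λ ())
    ... | p , pp , p∣m with prime-square-factor {k = k} pp p∣m coprime mn≡kk
    ...   | m′ , k′ , m≡m′pp , m′n≡k′k′
      with rec m′<m {k = k′} (coprime-∣ (divides (p * p) (trans m≡m′pp (*-comm m′ (p * p)))) ∣-refl coprime) m′n≡k′k′
      where
      1<pp : 1 < p * p
      1<pp = ≤-trans (nonTrivial⇒n>1 p {{prime⇒nonTrivial pp}}) (m≤m*n p p {{prime⇒nonZero pp}})
      m′<m : m′ < m
      m′<m = quotient-< (divides m′ m≡m′pp) {{n>1⇒nonTrivial 1<pp}}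
    ...     | a , refl = a * p , trans m≡m′pp (solve (a ∷ p ∷ []))

  coprime-product-squares : ∀ {m n k} → Coprime m n → m * n ≡ k * k →
                            ∃₂ λ a b → m ≡ a * a × n ≡ b * b
  coprime-product-squares {m} {n} {k} coprime mn≡kk
    with coprime-product-square {k = k} coprime mn≡kk
       | coprime-product-square {k = k} (coprime-sym coprime) (trans (*-comm n m) mn≡kk)
  ... | a , m≡aa | b , n≡bb = a , b , m≡aa , n≡bb

  coprime-product-fourth-powers : ∀ {m n k} → Coprime m n → m * n ≡ k * k * (k * k) →
    ∃₂ λ a b → m ≡ a * a * (a * a) × n ≡ b * b * (b * b) × k ≡ a * b × Coprime a b
  coprime-product-fourth-powers {k = k} coprime mn≡k⁴
    with coprime-product-squares {k = k * k} coprime mn≡k⁴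
  ... | A , B , refl , refl = fourth-roots (coprime-product-squares {k = k} coprimeAB AB≡kk)
    where
    open ≡-Reasoning
    AB≡kk : A * B ≡ k * k
    AB≡kk = m*m≡n*n⇒m≡n (begin
      A * B * (A * B)  ≡⟨ solve (A ∷ B ∷ []) ⟩
      A * A * (B * B)  ≡⟨ mn≡k⁴ ⟩
      k * k * (k * k)  ∎)
    coprimeAB : Coprime A B
    coprimeAB = coprime-∣ (∣m⇒∣m*n A ∣-refl) (∣m⇒∣m*n B ∣-refl) coprime
    fourth-roots : (∃₂ λ a b → A ≡ a * a × B ≡ b * b) →
      ∃₂ λ a b → A * A ≡ a * a * (a * a) × B * B ≡ b * b * (b * b) × k ≡ a * b × Coprime a b
    fourth-roots (a , b , refl , refl) =
      a , b , refl , refl , m*m≡n*n⇒m≡n (begin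
        k * k                ≡⟨ AB≡kk ⟨
        a * a * (b * b)      ≡⟨ solve (a ∷ b ∷ []) ⟩
        a * b * (a * b)      ∎) ,
      coprime-∣ (∣m⇒∣m*n a ∣-refl) (∣m⇒∣m*n b ∣-refl) coprimeAB

  coprime-product-3-fourth-powers : ∀ {m n k} → Coprime m n → m * n ≡ 3 * (k * k * (k * k)) →
    ∃₂ λ a b → k ≡ a * b × Coprime a b ×
              (m ≡ 3 * (a * a * (a * a)) × n ≡ b * b * (b * b) ⊎ m ≡ b * b * (b * b) × n ≡ 3 * (a * a * (a * a)))
  coprime-product-3-fourth-powers {m} {n} {k} coprime mn≡3k⁴
    with euclidsLemma m n prime[3] (divides (k * k * (k * k)) (trans mn≡3k⁴ (*-comm 3 (k * k * (k * k)))))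
  ... | inj₁ (divides m′ refl) with coprime-product-fourth-powers {k = k} coprime′ m′n≡k⁴
    where
    coprime′ : Coprime m′ n
    coprime′ = coprime-∣ (∣m⇒∣m*n 3 ∣-refl) ∣-refl coprime
    m′n≡k⁴ : m′ * n ≡ k * k * (k * k)
    m′n≡k⁴ = *-cancelˡ-≡ _ _ 3 (begin
      3 * (m′ * n)             ≡⟨ solve (m′ ∷ n ∷ []) ⟩
      m′ * 3 * n               ≡⟨ mn≡3k⁴ ⟩
      3 * (k * k * (k * k))    ∎)
      where open ≡-Reasoning
  ...   | a , b , refl , refl , k≡ab , coprime-ab =
    a , b , k≡ab , coprime-ab , inj₁ (*-comm (a * a * (a * a)) 3 , refl)
  coprime-product-3-fourth-powers {m} {n} {k} coprime mn≡3k⁴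
      | inj₂ (divides n′ refl) with coprime-product-fourth-powers {k = k} coprime′ mn′≡k⁴
    where
    coprime′ : Coprime m n′
    coprime′ = coprime-∣ ∣-refl (∣m⇒∣m*n 3 ∣-refl) coprime
    mn′≡k⁴ : m * n′ ≡ k * k * (k * k)
    mn′≡k⁴ = *-cancelˡ-≡ _ _ 3 (begin
      3 * (m * n′)             ≡⟨ solve (m ∷ n′ ∷ []) ⟩
      m * (n′ * 3)             ≡⟨ mn≡3k⁴ ⟩
      3 * (k * k * (k * k))    ∎)
      where open ≡-Reasoning
  ...   | b , a , refl , refl , k≡ba , coprime-ba =
    a , b , trans k≡ba (*-comm b a) , coprime-sym coprime-ba , inj₂ (refl , *-comm (a * a * (a * a)) 3)

  odd-square-factors : ∀ {o P Y} → ¬ 2 ∣ o → o * o ≡ P * (P + 4 * Y) →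
                       (∀ {r} → Prime r → r ∣ P → r ∣ Y → ⊥) →
                       ∃₂ λ s t → 0 < s × P ≡ s * s × P + 4 * Y ≡ t * t
  odd-square-factors {o} {P} {Y} 2∤o oo≡P[P+4Y] ¬common
    with coprime-product-squares {k = o} (¬common-prime⇒coprime ¬common-factor) (sym oo≡P[P+4Y])
    where
    ¬common-factor : ∀ {r} → Prime r → r ∣ P → r ∣ P + 4 * Y → ⊥
    ¬common-factor pr r∣P r∣P+4Y with prime∣4*n pr (∣m+n∣m⇒∣n r∣P+4Y r∣P)
    ... | inj₁ refl = 2∤o (prime∣m*m⇒prime∣m prime[2] (subst (2 ∣_) (sym oo≡P[P+4Y]) (∣m⇒∣m*n _ r∣P)))
    ... | inj₂ r∣Y = ¬common pr r∣P r∣Y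
  ... | s , t , refl , P+4Y≡tt =
    s , t , 0<m*n⇒0<m (0<m*n⇒0<m (subst (0 <_) oo≡P[P+4Y] (*-mono-< (odd⇒0<m 2∤o) (odd⇒0<m 2∤o)))) , refl , P+4Y≡tt

  square-difference : ∀ {x y c} → x * x ≡ y * y + 4 * c →
                      ∃₂ λ f g → x ≡ f + g × g ≡ f + y × f * g ≡ c
  square-difference {x} {y} {c} xx≡yy+4c with m≡n+k⊎n≡m+1+k x y
  ... | inj₂ (d , refl) =
    contradiction xx≡yy+4c (<⇒≢ (<-≤-trans (*-mono-< (m<m+n x z<s) (m<m+n x z<s)) (m≤m+n _ (4 * c))))
  ... | inj₁ (d , refl) = halve (prime∣m*m⇒prime∣m prime[2] 2∣dd)
    where
    open ≡-Reasoning
    dd+2yd≡4c : d * d + 2 * (y * d) ≡ 4 * c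
    dd+2yd≡4c = +-cancelʳ-≡ (y * y) _ _ (begin
      d * d + 2 * (y * d) + y * y  ≡⟨ solve (y ∷ d ∷ []) ⟩
      (y + d) * (y + d)            ≡⟨ xx≡yy+4c ⟩
      y * y + 4 * c                ≡⟨ +-comm (y * y) _ ⟩
      4 * c + y * y                ∎)
    2∣dd : 2 ∣ d * d
    2∣dd = ∣m+n∣m⇒∣n (subst (2 ∣_) (trans (sym dd+2yd≡4c) (+-comm (d * d) _)) (divides (2 * c) (solve (c ∷ []))))
                      (divides (y * d) (*-comm 2 (y * d)))
    halve : 2 ∣ d → ∃₂ λ f g → y + d ≡ f + g × g ≡ f + y × f * g ≡ c
    halve (divides f d≡f*2) = f , f + y , trans (cong (y +_) d≡f*2) (solve (y ∷ f ∷ [])) , refl ,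
      *-cancelˡ-≡ _ _ 4 (begin
        4 * (f * (f + y))                    ≡⟨ solve (y ∷ f ∷ []) ⟩
        f * 2 * (f * 2) + 2 * (y * (f * 2))  ≡⟨ cong (λ e → e * e + 2 * (y * e)) d≡f*2 ⟨
        d * d + 2 * (y * d)                  ≡⟨ dd+2yd≡4c ⟩
        4 * c                                ∎)

  square-difference′ : ∀ {x y z c} → x * x + 2 * (y * z) ≡ y * y + z * z + 4 * c →
    ∃₂ λ f g → x ≡ f + g × f * g ≡ c × (y + f ≡ z + g ⊎ y + g ≡ z + f)
  square-difference′ {x} {y} {z} {c} eq with m≡n+k⊎n≡m+1+k y z
  ... | inj₁ (d , refl)
    with square-difference {x} {d} {c} (+-cancelʳ-≡ (2 * (z * z) + 2 * (d * z)) _ _ (begin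
      x * x + (2 * (z * z) + 2 * (d * z))        ≡⟨ solve (x ∷ z ∷ d ∷ []) ⟩
      x * x + 2 * ((z + d) * z)                  ≡⟨ eq ⟩
      (z + d) * (z + d) + z * z + 4 * c          ≡⟨ solve (z ∷ d ∷ c ∷ []) ⟩
      d * d + 4 * c + (2 * (z * z) + 2 * (d * z)) ∎))
    where open ≡-Reasoning
  ...   | f , g , x≡f+g , refl , fg≡c = f , f + d , x≡f+g , fg≡c , inj₁ (solve (z ∷ d ∷ f ∷ []))
  square-difference′ {x} {y} {z} {c} eq | inj₂ (d , refl)
    with square-difference {x} {suc d} {c} (+-cancelʳ-≡ (2 * (y * y) + 2 * (suc d * y)) _ _ (begin
      x * x + (2 * (y * y) + 2 * (suc d * y))        ≡⟨ solve (x ∷ y ∷ d ∷ []) ⟩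
      x * x + 2 * (y * (y + suc d))                  ≡⟨ eq ⟩
      y * y + (y + suc d) * (y + suc d) + 4 * c      ≡⟨ solve (y ∷ d ∷ c ∷ []) ⟩
      suc d * suc d + 4 * c + (2 * (y * y) + 2 * (suc d * y)) ∎))
    where open ≡-Reasoning
  ...   | f , g , x≡f+g , refl , fg≡c = f , f + suc d , x≡f+g , fg≡c , inj₂ (solve (y ∷ d ∷ f ∷ []))

  odd-sum-split : ∀ {f g k} j → ¬ 2 ∣ f + g → f * g ≡ 2 ^ j * k →
                  ∃₂ λ F G → f + g ≡ 2 ^ j * F + G × F * G ≡ k × ¬ 2 ∣ G
  odd-sum-split {f} {g} {k} j 2∤f+g fg≡2^jk with 2 ∣? f | 2 ∣? g
  ... | yes 2∣f | yes 2∣g = contradiction (∣m∣n⇒∣m+n 2∣f 2∣g) 2∤f+g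
  ... | no 2∤f | no 2∤g = contradiction (odd+odd⇒even 2∤f 2∤g) 2∤f+g
  ... | yes _ | no 2∤g with 2^j∣m*n⇒2^j∣m {f} {g} j 2∤g (divides k (trans fg≡2^jk (*-comm (2 ^ j) k)))
  ...   | divides F refl = F , g , cong (_+ g) (*-comm F (2 ^ j)) , cancel , 2∤g
    where
    cancel : F * g ≡ k
    cancel = *-cancelˡ-≡ _ _ (2 ^ j) {{m^n≢0 2 j}}
      (trans (sym (trans (cong (_* g) (*-comm F (2 ^ j))) (*-assoc (2 ^ j) F g))) fg≡2^jk)
  odd-sum-split {f} {g} {k} j 2∤f+g fg≡2^jk | no 2∤f | yes _
    with 2^j∣m*n⇒2^j∣m {g} {f} j 2∤f (divides k (trans (*-comm g f) (trans fg≡2^jk (*-comm (2 ^ j) k))))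
  ...   | divides G refl = G , f , trans (+-comm f _) (cong (_+ f) (*-comm G (2 ^ j))) , cancel , 2∤f
    where
    cancel : G * f ≡ k
    cancel = *-cancelˡ-≡ _ _ (2 ^ j) {{m^n≢0 2 j}}
      (trans (sym (trans (cong (_* f) (*-comm G (2 ^ j))) (*-assoc (2 ^ j) G f))) (trans (*-comm (G * 2 ^ j) f) fg≡2^jk))

  record Solution (m n : ℕ) : Set where
    constructor solution
    field
      u v       : ℕ
      n>0       : 0 < n
      u>0       : 0 < u
      mm≡nn+uu  : m * m ≡ n * n + u * u
      mm+3nn≡vv : m * m + 3 * (n * n) ≡ v * v

  SolutionBelow : ℕ → Set
  SolutionBelow k = ∃₂ λ m n → m < k × Solution m n

  SolutionBelow-mono : ∀ {k l} → k ≤ l → SolutionBelow k → SolutionBelow l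
  SolutionBelow-mono k≤l (m , n , m<k , sol) = m , n , <-≤-trans m<k k≤l , sol

  solution⇒n<m : ∀ {m n} → Solution m n → n < m
  solution⇒n<m {m} {n} (solution u _ _ u>0 mm≡nn+uu _) =
    m*m<n*n⇒m<n (subst (n * n <_) (sym mm≡nn+uu) (m<m+n (n * n) (*-mono-< u>0 u>0)))

  common-prime⇒smaller-solution : ∀ {p m n} → Prime p → p ∣ m → p ∣ n → Solution m n → SolutionBelow m
  common-prime⇒smaller-solution {p} pp (divides m′ refl) (divides n′ refl) sol@(solution u v n>0 u>0 mm≡nn+uu mm+3nn≡vv)
    with prime∣m*m⇒prime∣m {m = u} pp p∣uu | prime∣m*m⇒prime∣m {m = v} pp p∣vv
    where
    p∣uu : p ∣ u * u
    p∣uu = ∣m+n∣m⇒∣n (subst (p ∣_) mm≡nn+uu (∣m⇒∣m*n _ (n∣m*n m′))) (∣m⇒∣m*n _ (n∣m*n n′))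
    p∣vv : p ∣ v * v
    p∣vv = subst (p ∣_) mm+3nn≡vv
      (∣m∣n⇒∣m+n (∣m⇒∣m*n _ (n∣m*n m′)) (∣n⇒∣m*n 3 (∣m⇒∣m*n _ (n∣m*n n′))))
  ... | divides u′ refl | divides v′ refl =
    m′ , n′ , m′<m′p , solution u′ v′ (positive-factor n>0) (positive-factor u>0) (cancel eq₁) (cancel eq₂)
    where
    open ≡-Reasoning
    instance
      pp≢0 : NonZero (p * p)
      pp≢0 = m*n≢0 p p {{prime⇒nonZero pp}} {{prime⇒nonZero pp}}
    positive-factor : ∀ {k} → 0 < k * p → 0 < k
    positive-factor {0} ()
    positive-factor {suc _} _ = z<s
    cancel : ∀ {x y} → x * (p * p) ≡ y * (p * p) → x ≡ y
    cancel = *-cancelʳ-≡ _ _ (p * p)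
    eq₁ : m′ * m′ * (p * p) ≡ (n′ * n′ + u′ * u′) * (p * p)
    eq₁ = begin
      m′ * m′ * (p * p)               ≡⟨ solve (m′ ∷ p ∷ []) ⟩
      m′ * p * (m′ * p)               ≡⟨ mm≡nn+uu ⟩
      n′ * p * (n′ * p) + u′ * p * (u′ * p) ≡⟨ solve (n′ ∷ u′ ∷ p ∷ []) ⟩
      (n′ * n′ + u′ * u′) * (p * p)   ∎
    eq₂ : (m′ * m′ + 3 * (n′ * n′)) * (p * p) ≡ v′ * v′ * (p * p)
    eq₂ = begin
      (m′ * m′ + 3 * (n′ * n′)) * (p * p)       ≡⟨ solve (m′ ∷ n′ ∷ p ∷ []) ⟩
      m′ * p * (m′ * p) + 3 * (n′ * p * (n′ * p)) ≡⟨ mm+3nn≡vv ⟩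
      v′ * p * (v′ * p)                         ≡⟨ solve (v′ ∷ p ∷ []) ⟩
      v′ * v′ * (p * p)                         ∎
    m′<m′p : m′ < m′ * p
    m′<m′p = m<m*n m′ p {{>-nonZero (positive-factor (<-trans n>0 (solution⇒n<m sol)))}}
                        (nonTrivial⇒n>1 p {{prime⇒nonTrivial pp}})

  coprime-solution⇒quartic : ∀ {m n} → Coprime m n → Solution m n →
    ∃₂ λ a b → Coprime a b × n ≡ a * b × m * m + a * a * (b * b) ≡ a * a * (a * a) + b * b * (b * b)
  coprime-solution⇒quartic {m} {n} coprime (solution u v _ _ mm≡nn+uu mm+3nn≡vv)
    with square-difference {m * m + n * n} {u * v} {n * n * (n * n)} square-identity
    where
    open ≡-Reasoning
    -- Opaque so that the with-abstraction does not normalise the solver's proof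
    -- term, which exhausts memory; the same holds for the opaque blocks below.
    opaque
      square-identity : (m * m + n * n) * (m * m + n * n) ≡ u * v * (u * v) + 4 * (n * n * (n * n))
      square-identity = begin
        (m * m + n * n) * (m * m + n * n)                        ≡⟨ cong (λ M → (M + n * n) * (M + n * n)) mm≡nn+uu ⟩
        (n * n + u * u + n * n) * (n * n + u * u + n * n)        ≡⟨ solve (n ∷ u ∷ []) ⟩
        u * u * (n * n + u * u + 3 * (n * n)) + 4 * (n * n * (n * n)) ≡⟨ cong (λ M → u * u * (M + 3 * (n * n)) + 4 * (n * n * (n * n))) mm≡nn+uu ⟨
        u * u * (m * m + 3 * (n * n)) + 4 * (n * n * (n * n))    ≡⟨ cong (λ V → u * u * V + 4 * (n * n * (n * n))) mm+3nn≡vv ⟩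
        u * u * (v * v) + 4 * (n * n * (n * n))                  ≡⟨ solve (u ∷ v ∷ n ∷ []) ⟩
        u * v * (u * v) + 4 * (n * n * (n * n))                  ∎
  ... | f , g , sum≡f+g , _ , fg≡n⁴ with coprime-product-fourth-powers {k = n} (¬common-prime⇒coprime ¬common) fg≡n⁴
    where
    ¬common : ∀ {r} → Prime r → r ∣ f → r ∣ g → ⊥
    ¬common {r} pr r∣f r∣g = coprime⇒¬common-prime coprime pr r∣m r∣n
      where
      r∣n : r ∣ n
      r∣n = prime∣m⁴⇒prime∣m pr
        (common-prime-factor∣ pr r∣f r∣g (trans fg≡n⁴ (sym (*-identityˡ _))) (prime-square∤ pr z<s (s<s z<s)))
      r∣m : r ∣ m
      r∣m = prime∣m*m⇒prime∣m pr (∣m+n∣m⇒∣n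
        (subst (r ∣_) (trans (sym sum≡f+g) (+-comm (m * m) (n * n))) (∣m∣n⇒∣m+n r∣f r∣g)) (∣m⇒∣m*n n r∣n))
  ... | a , b , refl , refl , n≡ab , coprime-ab = a , b , coprime-ab , n≡ab , (begin
    m * m + a * a * (b * b)  ≡⟨ cong (m * m +_) (solve (a ∷ b ∷ [])) ⟩
    m * m + a * b * (a * b)  ≡⟨ cong (λ k → m * m + k * k) n≡ab ⟨
    m * m + n * n            ≡⟨ sum≡f+g ⟩
    a * a * (a * a) + b * b * (b * b) ∎)
    where open ≡-Reasoning

  c²<d²⇒p²+3d⁴≢c⁴+2c²d² : ∀ {p c d e} → d * d ≡ c * c + suc e →
    p * p + 3 * (d * d * (d * d)) ≢ c * c * (c * c) + 2 * (c * c * (d * d))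
  c²<d²⇒p²+3d⁴≢c⁴+2c²d² {p} {c} {d} {e} dd≡cc+1+e eq =
    contradiction (m+n≡0⇒n≡0 (p * p + 4 * (c * c * suc e)) excess≡0) λ ()
    where
    open ≡-Reasoning
    excess≡0 : p * p + 4 * (c * c * suc e) + 3 * (suc e * suc e) ≡ 0
    excess≡0 = +-cancelʳ-≡ (3 * (c * c * (c * c)) + 2 * (c * c * suc e)) _ 0 (begin
      p * p + 4 * (c * c * suc e) + 3 * (suc e * suc e) + (3 * (c * c * (c * c)) + 2 * (c * c * suc e))
        ≡⟨ solve (p ∷ c ∷ e ∷ []) ⟩
      p * p + 3 * ((c * c + suc e) * (c * c + suc e))     ≡⟨ cong (λ D → p * p + 3 * (D * D)) dd≡cc+1+e ⟨
      p * p + 3 * (d * d * (d * d))                       ≡⟨ eq ⟩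
      c * c * (c * c) + 2 * (c * c * (d * d))             ≡⟨ cong (λ D → c * c * (c * c) + 2 * (c * c * D)) dd≡cc+1+e ⟩
      c * c * (c * c) + 2 * (c * c * (c * c + suc e))     ≡⟨ solve (c ∷ e ∷ []) ⟩
      0 + (3 * (c * c * (c * c)) + 2 * (c * c * suc e))   ∎)

  -- p² = (c² − d²)(c² + 3d²)
  p²+3d⁴≡c⁴+2c²d²⇒solution : ∀ {p c d} → ¬ 2 ∣ p → Coprime c d → 0 < d →
    p * p + 3 * (d * d * (d * d)) ≡ c * c * (c * c) + 2 * (c * c * (d * d)) → Solution c d
  p²+3d⁴≡c⁴+2c²d²⇒solution {p} {c} {d} 2∤p coprime d>0 eq with m≡n+k⊎n≡m+1+k (c * c) (d * d)
  ... | inj₂ (_ , dd≡cc+1+e) = contradiction eq (c²<d²⇒p²+3d⁴≢c⁴+2c²d² {p} {c} {d} dd≡cc+1+e)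
  ... | inj₁ (e , cc≡dd+e) with odd-square-factors {p} {e} {d * d} 2∤p pp≡e[e+4dd] ¬common
    where
    open ≡-Reasoning
    opaque
      pp≡e[e+4dd] : p * p ≡ e * (e + 4 * (d * d))
      pp≡e[e+4dd] = +-cancelʳ-≡ (3 * (d * d * (d * d))) _ _ (begin
        p * p + 3 * (d * d * (d * d))                  ≡⟨ eq ⟩
        c * c * (c * c) + 2 * (c * c * (d * d))        ≡⟨ cong (λ C → C * C + 2 * (C * (d * d))) cc≡dd+e ⟩
        (d * d + e) * (d * d + e) + 2 * ((d * d + e) * (d * d)) ≡⟨ solve (d ∷ e ∷ []) ⟩
        e * (e + 4 * (d * d)) + 3 * (d * d * (d * d))  ∎)
    ¬common : ∀ {r} → Prime r → r ∣ e → r ∣ d * d → ⊥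
    ¬common {r} pr r∣e r∣dd = coprime⇒¬common-prime coprime pr
      (prime∣m*m⇒prime∣m pr (subst (r ∣_) (sym cc≡dd+e) (∣m∣n⇒∣m+n r∣dd r∣e)))
      (prime∣m*m⇒prime∣m pr r∣dd)
  ... | u , v , u>0 , refl , uu+4dd≡vv = solution u v d>0 u>0 cc≡dd+e (begin
    c * c + 3 * (d * d)          ≡⟨ cong (_+ 3 * (d * d)) cc≡dd+e ⟩
    d * d + u * u + 3 * (d * d)  ≡⟨ solve (d ∷ u ∷ []) ⟩
    u * u + 4 * (d * d)          ≡⟨ uu+4dd≡vv ⟩
    v * v                        ∎)
    where open ≡-Reasoning

  3d²<c²⇒p²+c⁴≢3d⁴+2c²d² : ∀ {p c d h} → c * c ≡ 3 * (d * d) + suc h →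
    p * p + c * c * (c * c) ≢ 3 * (d * d * (d * d)) + 2 * (c * c * (d * d))
  3d²<c²⇒p²+c⁴≢3d⁴+2c²d² {p} {c} {d} {h} cc≡3dd+1+h eq =
    contradiction (m+n≡0⇒n≡0 (p * p + 4 * (d * d * suc h)) excess≡0) λ ()
    where
    open ≡-Reasoning
    excess≡0 : p * p + 4 * (d * d * suc h) + suc h * suc h ≡ 0
    excess≡0 = +-cancelʳ-≡ (9 * (d * d * (d * d)) + 2 * (d * d * suc h)) _ 0 (begin
      p * p + 4 * (d * d * suc h) + suc h * suc h + (9 * (d * d * (d * d)) + 2 * (d * d * suc h))
        ≡⟨ solve (p ∷ d ∷ h ∷ []) ⟩
      p * p + (3 * (d * d) + suc h) * (3 * (d * d) + suc h)            ≡⟨ cong (λ C → p * p + C * C) cc≡3dd+1+h ⟨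
      p * p + c * c * (c * c)                                          ≡⟨ eq ⟩
      3 * (d * d * (d * d)) + 2 * (c * c * (d * d))                    ≡⟨ cong (λ C → 3 * (d * d * (d * d)) + 2 * (C * (d * d))) cc≡3dd+1+h ⟩
      3 * (d * d * (d * d)) + 2 * ((3 * (d * d) + suc h) * (d * d))    ≡⟨ solve (d ∷ h ∷ []) ⟩
      0 + (9 * (d * d * (d * d)) + 2 * (d * d * suc h))                ∎)

  -- p² = (3d² − c²)(c² + d²)
  p²+c⁴≢3d⁴+2c²d² : ∀ {p c d} → ¬ 2 ∣ p → Coprime c d →
    p * p + c * c * (c * c) ≢ 3 * (d * d * (d * d)) + 2 * (c * c * (d * d))
  p²+c⁴≢3d⁴+2c²d² {p} {c} {d} 2∤p coprime eq with m≡n+k⊎n≡m+1+k (3 * (d * d)) (c * c)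
  ... | inj₂ (_ , cc≡3dd+1+h) = contradiction eq (3d²<c²⇒p²+c⁴≢3d⁴+2c²d² {p} {c} {d} cc≡3dd+1+h)
  ... | inj₁ (h , 3dd≡cc+h) with coprime-product-squares {k = p} coprime-h (sym pp≡h[cc+dd])
    where
    open ≡-Reasoning
    opaque
      pp≡h[cc+dd] : p * p ≡ h * (c * c + d * d)
      pp≡h[cc+dd] = *-cancelˡ-≡ _ _ 3 (+-cancelʳ-≡ (3 * (c * c * (c * c))) _ _ (begin
        3 * (p * p) + 3 * (c * c * (c * c))                           ≡⟨ solve (p ∷ c ∷ []) ⟩
        3 * (p * p + c * c * (c * c))                                 ≡⟨ cong (3 *_) eq ⟩
        3 * (3 * (d * d * (d * d)) + 2 * (c * c * (d * d)))           ≡⟨ solve (c ∷ d ∷ []) ⟩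
        3 * (d * d) * (3 * (d * d)) + 2 * (c * c * (3 * (d * d)))     ≡⟨ cong (λ T → T * T + 2 * (c * c * T)) 3dd≡cc+h ⟩
        (c * c + h) * (c * c + h) + 2 * (c * c * (c * c + h))         ≡⟨ solve (c ∷ h ∷ []) ⟩
        h * (3 * (c * c) + (c * c + h)) + 3 * (c * c * (c * c))       ≡⟨ cong (λ T → h * (3 * (c * c) + T) + 3 * (c * c * (c * c))) 3dd≡cc+h ⟨
        h * (3 * (c * c) + 3 * (d * d)) + 3 * (c * c * (c * c))       ≡⟨ solve (c ∷ d ∷ h ∷ []) ⟩
        3 * (h * (c * c + d * d)) + 3 * (c * c * (c * c))             ∎))
    coprime-h : Coprime h (c * c + d * d)
    coprime-h = ¬common-prime⇒coprime ¬common
      where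
      opaque
        sum≡4dd : c * c + d * d + h ≡ 4 * (d * d)
        sum≡4dd = begin
          c * c + d * d + h        ≡⟨ solve (c ∷ d ∷ h ∷ []) ⟩
          d * d + (c * c + h)      ≡⟨ cong (d * d +_) 3dd≡cc+h ⟨
          d * d + 3 * (d * d)      ≡⟨ solve (d ∷ []) ⟩
          4 * (d * d)              ∎
      ¬common : ∀ {r} → Prime r → r ∣ h → r ∣ c * c + d * d → ⊥
      ¬common {r} pr r∣h r∣cc+dd with prime∣4*n pr (subst (r ∣_) sum≡4dd (∣m∣n⇒∣m+n r∣cc+dd r∣h))
      ... | inj₁ refl = 2∤p (prime∣m*m⇒prime∣m prime[2] (subst (2 ∣_) (sym pp≡h[cc+dd]) (∣m⇒∣m*n _ r∣h)))
      ... | inj₂ r∣dd = coprime⇒¬common-prime coprime pr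
        (prime∣m*m⇒prime∣m pr (∣m+n∣m⇒∣n (subst (r ∣_) (+-comm (c * c) (d * d)) r∣cc+dd) r∣dd))
        (prime∣m*m⇒prime∣m pr r∣dd)
  ... | x , _ , refl , _ with m*m+n*n≡3*k*k⇒3∣m×3∣k {n = x} {k = d} (sym 3dd≡cc+h)
  ...   | 3∣c , 3∣d = coprime⇒¬common-prime coprime prime[3] 3∣c 3∣d

  ±-difference-swap : ∀ {P Q f g F G} → f ≡ F × g ≡ G ⊎ f ≡ G × g ≡ F →
                      P + f ≡ Q + g ⊎ P + g ≡ Q + f → P + F ≡ Q + G ⊎ P + G ≡ Q + F
  ±-difference-swap (inj₁ (refl , refl)) sign = sign
  ±-difference-swap (inj₂ (refl , refl)) (inj₁ eq) = inj₂ eq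
  ±-difference-swap (inj₂ (refl , refl)) (inj₂ eq) = inj₁ eq

  w²+4p²b²≡p⁴+16b⁴⇒solution : ∀ {p b w} → ¬ 2 ∣ p → Coprime p b → 0 < b →
    w * w + 4 * (p * p * (b * b)) ≡ p * p * (p * p) + 16 * (b * b * (b * b)) → SolutionBelow (suc b)
  w²+4p²b²≡p⁴+16b⁴⇒solution {p} {b} {w} 2∤p coprime b>0 eq
    with square-difference′ {w} {p * p} {2 * (b * b)} {3 * (b * b * (b * b))} eq′
    where
    open ≡-Reasoning
    opaque
      eq′ : w * w + 2 * (p * p * (2 * (b * b))) ≡ p * p * (p * p) + 2 * (b * b) * (2 * (b * b)) + 4 * (3 * (b * b * (b * b)))
      eq′ = begin
        w * w + 2 * (p * p * (2 * (b * b)))        ≡⟨ solve (w ∷ p ∷ b ∷ []) ⟩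
        w * w + 4 * (p * p * (b * b))              ≡⟨ eq ⟩
        p * p * (p * p) + 16 * (b * b * (b * b))   ≡⟨ solve (p ∷ b ∷ []) ⟩
        p * p * (p * p) + 2 * (b * b) * (2 * (b * b)) + 4 * (3 * (b * b * (b * b))) ∎
  ... | f , g , _ , fg≡3b⁴ , sign with coprime-product-3-fourth-powers {k = b} (¬common-prime⇒coprime ¬common) fg≡3b⁴
    where
    ¬common : ∀ {r} → Prime r → r ∣ f → r ∣ g → ⊥
    ¬common {r} pr r∣f r∣g = coprime⇒¬common-prime coprime pr (prime∣m*m⇒prime∣m pr r∣pp) r∣b
      where
      r∣b : r ∣ b
      r∣b = prime∣m⁴⇒prime∣m pr (common-prime-factor∣ pr r∣f r∣g fg≡3b⁴ (prime-square∤ pr z<s (s<s (s<s (s<s z<s)))))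
      r∣2bb : r ∣ 2 * (b * b)
      r∣2bb = ∣n⇒∣m*n 2 (∣m⇒∣m*n b r∣b)
      r∣pp : r ∣ p * p
      r∣pp = [ (λ pp+f≡2bb+g → ∣m+n∣m⇒∣n
                 (subst (r ∣_) (trans (sym pp+f≡2bb+g) (+-comm (p * p) f)) (∣m∣n⇒∣m+n r∣2bb r∣g)) r∣f)
             , (λ pp+g≡2bb+f → ∣m+n∣m⇒∣n
                 (subst (r ∣_) (trans (sym pp+g≡2bb+f) (+-comm (p * p) g)) (∣m∣n⇒∣m+n r∣2bb r∣f)) r∣g)
             ]′ sign
  ... | x , y , refl , coprime-xy , powers with ±-difference-swap powers sign
  ...   | inj₁ good =
    y , x , s≤s (m≤n*m y x {{>-nonZero x>0}}) , p²+3d⁴≡c⁴+2c²d²⇒solution 2∤p (coprime-sym coprime-xy) x>0 (begin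
      p * p + 3 * (x * x * (x * x))                    ≡⟨ good ⟩
      2 * (x * y * (x * y)) + y * y * (y * y)          ≡⟨ solve (x ∷ y ∷ []) ⟩
      y * y * (y * y) + 2 * (y * y * (x * x))          ∎)
    where
    open ≡-Reasoning
    x>0 : 0 < x
    x>0 = 0<m*n⇒0<m b>0
  ...   | inj₂ bad = contradiction (begin
      p * p + y * y * (y * y)                          ≡⟨ bad ⟩
      2 * (x * y * (x * y)) + 3 * (x * x * (x * x))    ≡⟨ solve (x ∷ y ∷ []) ⟩
      3 * (x * x * (x * x)) + 2 * (y * y * (x * x))    ∎) (p²+c⁴≢3d⁴+2c²d² 2∤p (coprime-sym coprime-xy))
    where open ≡-Reasoning

  o²+28x²y²≢64y⁴+3x⁴ : ∀ {o x y} → ¬ 2 ∣ o → ¬ 2 ∣ x →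
    o * o + 28 * (x * x * (y * y)) ≢ 64 * (y * y * (y * y)) + 3 * (x * x * (x * x))
  o²+28x²y²≢64y⁴+3x⁴ {o} {x} {y} 2∤o 2∤x eq
    with odd-square 2∤o | odd-square {x * x} (λ 2∣xx → 2∤x (prime∣m*m⇒prime∣m prime[2] 2∣xx))
  ... | i , oo≡1+4i | j , x⁴≡1+4j = 1+4a≢3+4b (i + 7 * (x * x * (y * y))) (16 * (y * y * (y * y)) + 3 * j) (begin
    1 + 4 * (i + 7 * (x * x * (y * y)))             ≡⟨ solve (i ∷ x ∷ y ∷ []) ⟩
    1 + 4 * i + 28 * (x * x * (y * y))              ≡⟨ cong (_+ 28 * (x * x * (y * y))) oo≡1+4i ⟨
    o * o + 28 * (x * x * (y * y))                  ≡⟨ eq ⟩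
    64 * (y * y * (y * y)) + 3 * (x * x * (x * x))  ≡⟨ cong (λ X → 64 * (y * y * (y * y)) + 3 * X) x⁴≡1+4j ⟩
    64 * (y * y * (y * y)) + 3 * (1 + 4 * j)        ≡⟨ solve (y ∷ j ∷ []) ⟩
    3 + 4 * (16 * (y * y * (y * y)) + 3 * j)        ∎)
    where open ≡-Reasoning

  module _ {o x y : ℕ} (2∤o : ¬ 2 ∣ o) (coprime : Coprime x y)
           (eq : o * o + 28 * (x * x * (y * y)) ≡ x * x * (x * x) + 192 * (y * y * (y * y))) where
    open ≡-Reasoning

    16y²≤x²⇒solution : 0 < y → ∀ P → x * x ≡ 16 * (y * y) + P → SolutionBelow (suc x)
    16y²≤x²⇒solution y>0 P xx≡16yy+P with odd-square-factors {o} {P} {y * y} 2∤o oo≡P[P+4yy] ¬common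
      where
      opaque
        oo≡P[P+4yy] : o * o ≡ P * (P + 4 * (y * y))
        oo≡P[P+4yy] = +-cancelʳ-≡ (28 * ((16 * (y * y) + P) * (y * y))) _ _ (begin
          o * o + 28 * ((16 * (y * y) + P) * (y * y))                     ≡⟨ cong (λ X → o * o + 28 * (X * (y * y))) xx≡16yy+P ⟨
          o * o + 28 * (x * x * (y * y))                                  ≡⟨ eq ⟩
          x * x * (x * x) + 192 * (y * y * (y * y))                       ≡⟨ cong (λ X → X * X + 192 * (y * y * (y * y))) xx≡16yy+P ⟩
          (16 * (y * y) + P) * (16 * (y * y) + P) + 192 * (y * y * (y * y)) ≡⟨ solve (y ∷ P ∷ []) ⟩
          P * (P + 4 * (y * y)) + 28 * ((16 * (y * y) + P) * (y * y))     ∎)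
        ¬common : ∀ {r} → Prime r → r ∣ P → r ∣ y * y → ⊥
        ¬common {r} pr r∣P r∣yy = coprime⇒¬common-prime coprime pr
          (prime∣m*m⇒prime∣m pr (subst (r ∣_) (sym xx≡16yy+P) (∣m∣n⇒∣m+n (∣n⇒∣m*n 16 r∣yy) r∣P)))
          (prime∣m*m⇒prime∣m pr r∣yy)
    ... | s , t , s>0 , refl , ss+4yy≡tt =
      t , 2 * y , s≤s (m*m≤n*n⇒m≤n (subst (t * t ≤_) tt+12yy≡xx (m≤m+n (t * t) _))) ,
      solution s x (*-monoʳ-< 2 y>0) s>0 tt≡2y2y+ss tt+3[2y2y]≡xx
      where
      tt≡2y2y+ss : t * t ≡ 2 * y * (2 * y) + s * s
      tt≡2y2y+ss = begin
        t * t                    ≡⟨ ss+4yy≡tt ⟨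
        s * s + 4 * (y * y)      ≡⟨ solve (s ∷ y ∷ []) ⟩
        2 * y * (2 * y) + s * s  ∎
      tt+12yy≡xx : t * t + 12 * (y * y) ≡ x * x
      tt+12yy≡xx = begin
        t * t + 12 * (y * y)               ≡⟨ cong (_+ 12 * (y * y)) ss+4yy≡tt ⟨
        s * s + 4 * (y * y) + 12 * (y * y) ≡⟨ solve (s ∷ y ∷ []) ⟩
        16 * (y * y) + s * s               ≡⟨ xx≡16yy+P ⟨
        x * x                              ∎
      tt+3[2y2y]≡xx : t * t + 3 * (2 * y * (2 * y)) ≡ x * x
      tt+3[2y2y]≡xx = begin
        t * t + 3 * (2 * y * (2 * y))  ≡⟨ cong (t * t +_) (solve (y ∷ [])) ⟩
        t * t + 12 * (y * y)           ≡⟨ tt+12yy≡xx ⟩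
        x * x                          ∎

    12y²≤x²<16y²⇒⊥ : ∀ P h → x * x ≡ 12 * (y * y) + P → 16 * (y * y) ≡ x * x + suc h → ⊥
    12y²≤x²<16y²⇒⊥ P h xx≡12yy+P 16yy≡xx+1+h =
      <⇒≢ (*-mono-< (odd⇒0<m 2∤o) (odd⇒0<m 2∤o)) (sym (m+n≡0⇒m≡0 (o * o) oo+P[1+h]≡0))
      where
      oo+4Pyy≡PP : o * o + P * (4 * (y * y)) ≡ P * P
      oo+4Pyy≡PP = +-cancelʳ-≡ (336 * (y * y * (y * y)) + 24 * (P * (y * y))) _ _ (begin
        o * o + P * (4 * (y * y)) + (336 * (y * y * (y * y)) + 24 * (P * (y * y))) ≡⟨ solve (o ∷ y ∷ P ∷ []) ⟩
        o * o + 28 * ((12 * (y * y) + P) * (y * y))                       ≡⟨ cong (λ X → o * o + 28 * (X * (y * y))) xx≡12yy+P ⟨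
        o * o + 28 * (x * x * (y * y))                                    ≡⟨ eq ⟩
        x * x * (x * x) + 192 * (y * y * (y * y))                         ≡⟨ cong (λ X → X * X + 192 * (y * y * (y * y))) xx≡12yy+P ⟩
        (12 * (y * y) + P) * (12 * (y * y) + P) + 192 * (y * y * (y * y)) ≡⟨ solve (y ∷ P ∷ []) ⟩
        P * P + (336 * (y * y * (y * y)) + 24 * (P * (y * y)))           ∎)
      4yy≡P+1+h : 4 * (y * y) ≡ P + suc h
      4yy≡P+1+h = +-cancelˡ-≡ (12 * (y * y)) _ _ (begin
        12 * (y * y) + 4 * (y * y)   ≡⟨ solve (y ∷ []) ⟩
        16 * (y * y)                 ≡⟨ 16yy≡xx+1+h ⟩
        x * x + suc h                ≡⟨ cong (_+ suc h) xx≡12yy+P ⟩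
        12 * (y * y) + P + suc h     ≡⟨ +-assoc (12 * (y * y)) P (suc h) ⟩
        12 * (y * y) + (P + suc h)   ∎)
      oo+P[1+h]≡0 : o * o + P * suc h ≡ 0
      oo+P[1+h]≡0 = +-cancelʳ-≡ (P * P) _ 0 (begin
        o * o + P * suc h + P * P    ≡⟨ solve (o ∷ P ∷ h ∷ []) ⟩
        o * o + P * (P + suc h)      ≡⟨ cong (λ Q → o * o + P * Q) 4yy≡P+1+h ⟨
        o * o + P * (4 * (y * y))    ≡⟨ oo+4Pyy≡PP ⟩
        P * P                        ∎)

    x²<12y²⇒⊥ : ∀ R → 12 * (y * y) ≡ x * x + suc R → ⊥
    x²<12y²⇒⊥ R 12yy≡xx+1+R with odd-square-factors {o} {suc R} {y * y} 2∤o oo≡R[R+4yy] ¬common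
      where
      opaque
        oo≡R[R+4yy] : o * o ≡ suc R * (suc R + 4 * (y * y))
        oo≡R[R+4yy] = *-cancelˡ-≡ _ _ 3 (+-cancelʳ-≡ (7 * (x * x * (x * x + suc R))) _ _ (begin
          3 * (o * o) + 7 * (x * x * (x * x + suc R))      ≡⟨ cong (λ T → 3 * (o * o) + 7 * (x * x * T)) 12yy≡xx+1+R ⟨
          3 * (o * o) + 7 * (x * x * (12 * (y * y)))       ≡⟨ solve (o ∷ x ∷ y ∷ []) ⟩
          3 * (o * o + 28 * (x * x * (y * y)))             ≡⟨ cong (3 *_) eq ⟩
          3 * (x * x * (x * x) + 192 * (y * y * (y * y)))  ≡⟨ solve (x ∷ y ∷ []) ⟩
          3 * (x * x * (x * x)) + 4 * (12 * (y * y) * (12 * (y * y))) ≡⟨ cong (λ T → 3 * (x * x * (x * x)) + 4 * (T * T)) 12yy≡xx+1+R ⟩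
          3 * (x * x * (x * x)) + 4 * ((x * x + suc R) * (x * x + suc R)) ≡⟨ solve (x ∷ R ∷ []) ⟩
          3 * (suc R * suc R) + suc R * (x * x + suc R) + 7 * (x * x * (x * x + suc R)) ≡⟨ cong (λ T → 3 * (suc R * suc R) + suc R * T + 7 * (x * x * (x * x + suc R))) 12yy≡xx+1+R ⟨
          3 * (suc R * suc R) + suc R * (12 * (y * y)) + 7 * (x * x * (x * x + suc R)) ≡⟨ solve (x ∷ y ∷ R ∷ []) ⟩
          3 * (suc R * (suc R + 4 * (y * y))) + 7 * (x * x * (x * x + suc R)) ∎))
        ¬common : ∀ {r} → Prime r → r ∣ suc R → r ∣ y * y → ⊥
        ¬common {r} pr r∣R r∣yy = coprime⇒¬common-prime coprime pr
          (prime∣m*m⇒prime∣m pr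
            (∣m+n∣m⇒∣n (subst (r ∣_) (trans 12yy≡xx+1+R (+-comm (x * x) _)) (∣n⇒∣m*n 12 r∣yy)) r∣R))
          (prime∣m*m⇒prime∣m pr r∣yy)
    ... | s , _ , _ , 1+R≡ss , _ with m*m+n*n≡3*k*k⇒3∣m×3∣k {x} {s} {2 * y} xx+ss≡3[2y2y]
      where
      opaque
        xx+ss≡3[2y2y] : x * x + s * s ≡ 3 * (2 * y * (2 * y))
        xx+ss≡3[2y2y] = begin
          x * x + s * s          ≡⟨ cong (x * x +_) 1+R≡ss ⟨
          x * x + suc R          ≡⟨ 12yy≡xx+1+R ⟨
          12 * (y * y)           ≡⟨ solve (y ∷ []) ⟩
          3 * (2 * y * (2 * y))  ∎
    ...   | 3∣x , 3∣2y with euclidsLemma 2 y prime[3] 3∣2y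
    ...     | inj₁ 3∣2 = contradiction (∣⇒≤ 3∣2) λ { (s≤s (s≤s ())) }
    ...     | inj₂ 3∣y = coprime⇒¬common-prime coprime prime[3] 3∣x 3∣y

    -- o² = (x² − 12y²)(x² − 16y²); the cases are the possible signs of the factors.
    o²+28x²y²≡x⁴+192y⁴⇒solution : 0 < y → SolutionBelow (suc x)
    o²+28x²y²≡x⁴+192y⁴⇒solution y>0 = case m≡n+k⊎n≡m+1+k (x * x) (16 * (y * y)) of λ where
      (inj₁ (P , xx≡16yy+P)) → 16y²≤x²⇒solution y>0 P xx≡16yy+P
      (inj₂ (h , 16yy≡xx+1+h)) → case m≡n+k⊎n≡m+1+k (x * x) (12 * (y * y)) of λ where
        (inj₁ (P , xx≡12yy+P)) → ⊥-elim (12y²≤x²<16y²⇒⊥ P h xx≡12yy+P 16yy≡xx+1+h)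
        (inj₂ (R , 12yy≡xx+1+R)) → ⊥-elim (x²<12y²⇒⊥ R 12yy≡xx+1+R)

  opaque
    m²≡o⁴+56o²l²+16l⁴⇒o²+28l²≡64F+G : ∀ {m o l} → ¬ 2 ∣ o →
      m * m ≡ o * o * (o * o) + 56 * (o * o * (l * l)) + 16 * (l * l * (l * l)) →
      ∃₂ λ F G → o * o + 28 * (l * l) ≡ 64 * F + G × F * G ≡ 3 * (l * l * (l * l)) × ¬ 2 ∣ G
    m²≡o⁴+56o²l²+16l⁴⇒o²+28l²≡64F+G {m} {o} {l} 2∤o eq
      with square-difference {o * o + 28 * (l * l)} {m} {2 ^ 6 * (3 * (l * l * (l * l)))} UU≡mm+4c
      where
      opaque
        UU≡mm+4c : (o * o + 28 * (l * l)) * (o * o + 28 * (l * l)) ≡ m * m + 4 * (64 * (3 * (l * l * (l * l))))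
        UU≡mm+4c = begin
          (o * o + 28 * (l * l)) * (o * o + 28 * (l * l))                            ≡⟨ solve (o ∷ l ∷ []) ⟩
          o * o * (o * o) + 56 * (o * o * (l * l)) + 16 * (l * l * (l * l)) + 768 * (l * l * (l * l)) ≡⟨ cong (_+ 768 * (l * l * (l * l))) eq ⟨
          m * m + 768 * (l * l * (l * l))                                            ≡⟨ solve (m ∷ l ∷ []) ⟩
          m * m + 4 * (64 * (3 * (l * l * (l * l))))                                 ∎
          where open ≡-Reasoning
    ... | f , g , U≡f+g , _ , fg≡64·3l⁴ with odd-sum-split {f} {g} 6 (subst (¬_ ∘ (2 ∣_)) U≡f+g 2∤U) fg≡64·3l⁴
      where
      opaque
        2∤U : ¬ 2 ∣ o * o + 28 * (l * l)
        2∤U 2∣U = 2∤o (prime∣m*m⇒prime∣m prime[2]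
          (∣m+n∣m⇒∣n (subst (2 ∣_) (+-comm (o * o) _) 2∣U) (divides (14 * (l * l)) (solve (l ∷ [])))))
    ... | F , G , f+g≡64F+G , FG≡3l⁴ , 2∤G = F , G , trans U≡f+g f+g≡64F+G , FG≡3l⁴ , 2∤G

  m²≡o⁴+56o²l²+16l⁴⇒solution : ∀ {m o l} → ¬ 2 ∣ o → Coprime o l → 0 < l →
    m * m ≡ o * o * (o * o) + 56 * (o * o * (l * l)) + 16 * (l * l * (l * l)) → SolutionBelow (suc l)
  m²≡o⁴+56o²l²+16l⁴⇒solution {m} {o} {l} 2∤o coprime l>0 eq
    with m²≡o⁴+56o²l²+16l⁴⇒o²+28l²≡64F+G {m} {o} {l} 2∤o eq
  ... | F , G , U≡64F+G , FG≡3l⁴ , 2∤G with coprime-product-3-fourth-powers {k = l} (¬common-prime⇒coprime ¬common) FG≡3l⁴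
    where
    opaque
      ¬common : ∀ {r} → Prime r → r ∣ F → r ∣ G → ⊥
      ¬common {r} pr r∣F r∣G = coprime⇒¬common-prime coprime pr (prime∣m*m⇒prime∣m pr r∣oo) r∣l
        where
        r∣l : r ∣ l
        r∣l = prime∣m⁴⇒prime∣m pr
          (common-prime-factor∣ pr r∣F r∣G FG≡3l⁴ (prime-square∤ pr z<s (s<s (s<s (s<s z<s)))))
        r∣U : r ∣ o * o + 28 * (l * l)
        r∣U = subst (r ∣_) (sym U≡64F+G) (∣m∣n⇒∣m+n (∣n⇒∣m*n 64 r∣F) r∣G)
        r∣oo : r ∣ o * o
        r∣oo = ∣m+n∣m⇒∣n (subst (r ∣_) (+-comm (o * o) _) r∣U) (∣n⇒∣m*n 28 (∣m⇒∣m*n l r∣l))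
  ... | x , y , refl , coprime-xy , inj₁ (refl , refl) =
    SolutionBelow-mono (s≤s (m≤n*m y x {{>-nonZero (0<m*n⇒0<m l>0)}}))
      (o²+28x²y²≡x⁴+192y⁴⇒solution 2∤o (coprime-sym coprime-xy) (begin
        o * o + 28 * (y * y * (x * x))                       ≡⟨ cong (o * o +_) (solve (x ∷ y ∷ [])) ⟩
        o * o + 28 * (x * y * (x * y))                       ≡⟨ U≡64F+G ⟩
        64 * (3 * (x * x * (x * x))) + y * y * (y * y)       ≡⟨ solve (x ∷ y ∷ []) ⟩
        y * y * (y * y) + 192 * (x * x * (x * x))            ∎) (0<m*n⇒0<m l>0))
    where open ≡-Reasoning
  ... | x , y , refl , coprime-xy , inj₂ (refl , refl) =
    ⊥-elim (o²+28x²y²≢64y⁴+3x⁴ {o} {x} {y} 2∤o 2∤x (begin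
      o * o + 28 * (x * x * (y * y))                         ≡⟨ cong (o * o +_) (solve (x ∷ y ∷ [])) ⟩
      o * o + 28 * (x * y * (x * y))                         ≡⟨ U≡64F+G ⟩
      64 * (y * y * (y * y)) + 3 * (x * x * (x * x))         ∎))
    where
    open ≡-Reasoning
    2∤x : ¬ 2 ∣ x
    2∤x 2∣x = 2∤G (∣n⇒∣m*n 3 (∣m⇒∣m*n (x * x) (∣m⇒∣m*n x 2∣x)))

  m*m≡x+k⁴⇒k*k≤m : ∀ {m k} x → m * m ≡ x + k * k * (k * k) → k * k ≤ m
  m*m≡x+k⁴⇒k*k≤m {m} {k} x eq = m*m≤n*n⇒m≤n (subst (k * k * (k * k) ≤_) (sym eq) (m≤n+m _ x))

  m²≡k⁴+14k²l²+l⁴⇒solution : ∀ {m k l} → Coprime k l → ¬ 2 ∣ k → 2 ∣ l → 0 < l →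
    m * m ≡ k * k * (k * k) + 14 * (k * k * (l * l)) + l * l * (l * l) → SolutionBelow m
  m²≡k⁴+14k²l²+l⁴⇒solution {m} {k} coprime 2∤k (divides c refl) 0<l eq =
    SolutionBelow-mono c<m
      (m²≡o⁴+56o²l²+16l⁴⇒solution {m} 2∤k (coprime-∣ ∣-refl (∣m⇒∣m*n 2 ∣-refl) coprime) 0<c eq′)
    where
    eq′ : m * m ≡ k * k * (k * k) + 56 * (k * k * (c * c)) + 16 * (c * c * (c * c))
    eq′ = begin
      m * m                                                                      ≡⟨ eq ⟩
      k * k * (k * k) + 14 * (k * k * (c * 2 * (c * 2))) + c * 2 * (c * 2) * (c * 2 * (c * 2)) ≡⟨ solve (k ∷ c ∷ []) ⟩
      k * k * (k * k) + 56 * (k * k * (c * c)) + 16 * (c * c * (c * c))          ∎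
      where open ≡-Reasoning
    0<c : 0 < c
    0<c = 0<m*n⇒0<m 0<l
    c<m : suc c ≤ m
    c<m = begin-strict
      c                    <⟨ m<m*n c 2 {{>-nonZero 0<c}} (s<s z<s) ⟩
      c * 2                ≤⟨ m≤m*n (c * 2) (c * 2) {{>-nonZero 0<l}} ⟩
      c * 2 * (c * 2)      ≤⟨ m*m≡x+k⁴⇒k*k≤m {m} {c * 2} (k * k * (k * k) + 14 * (k * k * (c * 2 * (c * 2)))) eq ⟩
      m                    ∎
      where open ≤-Reasoning

  m²+a²b²≡a⁴+b⁴-sym : ∀ {m a b} → m * m + a * a * (b * b) ≡ a * a * (a * a) + b * b * (b * b) →
                       m * m + b * b * (a * a) ≡ b * b * (b * b) + a * a * (a * a)
  m²+a²b²≡a⁴+b⁴-sym {m} {a} {b} eq =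
    trans (cong (m * m +_) (*-comm (b * b) (a * a))) (trans eq (+-comm (a * a * (a * a)) _))

  m²+a²b²≡a⁴+b⁴⇒solution-odd-even : ∀ {m a b} → ¬ 2 ∣ a → 2 ∣ b → Coprime a b → 0 < b → a * b < m →
    m * m + a * a * (b * b) ≡ a * a * (a * a) + b * b * (b * b) → SolutionBelow m
  m²+a²b²≡a⁴+b⁴⇒solution-odd-even {m} {a} 2∤a (divides c refl) coprime 0<b ab<m eq =
    SolutionBelow-mono c<m
      (w²+4p²b²≡p⁴+16b⁴⇒solution {w = m} 2∤a (coprime-∣ ∣-refl (∣m⇒∣m*n 2 ∣-refl) coprime) 0<c eq′)
    where
    eq′ : m * m + 4 * (a * a * (c * c)) ≡ a * a * (a * a) + 16 * (c * c * (c * c))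
    eq′ = begin
      m * m + 4 * (a * a * (c * c))                             ≡⟨ cong (m * m +_) (solve (a ∷ c ∷ [])) ⟩
      m * m + a * a * (c * 2 * (c * 2))                         ≡⟨ eq ⟩
      a * a * (a * a) + c * 2 * (c * 2) * (c * 2 * (c * 2))     ≡⟨ solve (a ∷ c ∷ []) ⟩
      a * a * (a * a) + 16 * (c * c * (c * c))                  ∎
      where open ≡-Reasoning
    0<c : 0 < c
    0<c = 0<m*n⇒0<m 0<b
    c<m : suc c ≤ m
    c<m = begin-strict
      c            <⟨ m<m*n c 2 {{>-nonZero 0<c}} (s<s z<s) ⟩
      c * 2        ≤⟨ m≤n*m (c * 2) a {{>-nonZero (odd⇒0<m 2∤a)}} ⟩
      a * (c * 2)  <⟨ ab<m ⟩
      m            ∎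
      where open ≤-Reasoning

  m²+a²b²≡a⁴+b⁴⇒solution-odd-odd : ∀ {m b d} → ¬ 2 ∣ b + d → ¬ 2 ∣ b → Coprime (b + d) b → (b + d) * b < m →
    m * m + (b + d) * (b + d) * (b * b) ≡ (b + d) * (b + d) * ((b + d) * (b + d)) + b * b * (b * b) → SolutionBelow m
  m²+a²b²≡a⁴+b⁴⇒solution-odd-odd {m} {b} {d} 2∤a 2∤b coprime ab<m eq with 2∣d
    where
    opaque
      2∣d : 2 ∣ d
      2∣d = ∣m+n∣m⇒∣n (subst (2 ∣_) a+b≡2b+d (odd+odd⇒even 2∤a 2∤b)) (divides b (*-comm 2 b))
        where
        a+b≡2b+d : b + d + b ≡ 2 * b + d
        a+b≡2b+d = solve (b ∷ d ∷ [])
  ... | divides 0 refl = contradiction ab≡m (<⇒≢ ab<m)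
    where
    mm≡bbbb : m * m ≡ b * b * (b * b)
    mm≡bbbb = +-cancelʳ-≡ ((b + 0) * (b + 0) * (b * b)) _ _ (trans eq (solve (b ∷ [])))
    ab≡m : (b + 0) * b ≡ m
    ab≡m = trans (cong (_* b) (+-identityʳ b)) (sym (m*m≡n*n⇒m≡n mm≡bbbb))
  ... | divides (suc l) refl = case 2 ∣? suc l of λ where
      (yes 2∣l) → m²≡k⁴+14k²l²+l⁴⇒solution coprime-kl (2∤k 2∣l) 2∣l z<s mm≡k⁴+14k²l²+l⁴
      (no 2∤l) → m²≡k⁴+14k²l²+l⁴⇒solution (coprime-sym coprime-kl) 2∤l (odd+odd⇒even 2∤b 2∤l)
                   (<-≤-trans z<s (m≤n+m (suc l) b))
                   (trans mm≡k⁴+14k²l²+l⁴ (solve (b ∷ l ∷ [])))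
    where
    open ≡-Reasoning
    2∤k : 2 ∣ suc l → ¬ 2 ∣ b + suc l
    2∤k 2∣l 2∣k = 2∤b (∣m+n∣m⇒∣n (subst (2 ∣_) (+-comm b (suc l)) 2∣k) 2∣l)
    coprime-kl : Coprime (b + suc l) (suc l)
    coprime-kl = ¬common-prime⇒coprime λ {r} pr r∣k r∣l →
      let r∣b = ∣m+n∣m⇒∣n (subst (r ∣_) (+-comm b (suc l)) r∣k) r∣l in
      coprime⇒¬common-prime coprime pr (∣m∣n⇒∣m+n r∣b (∣m⇒∣m*n 2 r∣l)) r∣b
    mm≡k⁴+14k²l²+l⁴ : m * m ≡ (b + suc l) * (b + suc l) * ((b + suc l) * (b + suc l))
                              + 14 * ((b + suc l) * (b + suc l) * (suc l * suc l)) + suc l * suc l * (suc l * suc l)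
    mm≡k⁴+14k²l²+l⁴ = +-cancelʳ-≡ ((b + suc l * 2) * (b + suc l * 2) * (b * b)) _ _ (begin
      m * m + (b + suc l * 2) * (b + suc l * 2) * (b * b)                            ≡⟨ eq ⟩
      (b + suc l * 2) * (b + suc l * 2) * ((b + suc l * 2) * (b + suc l * 2)) + b * b * (b * b) ≡⟨ solve (b ∷ l ∷ []) ⟩
      (b + suc l) * (b + suc l) * ((b + suc l) * (b + suc l)) + 14 * ((b + suc l) * (b + suc l) * (suc l * suc l))
        + suc l * suc l * (suc l * suc l) + (b + suc l * 2) * (b + suc l * 2) * (b * b) ∎)

  m²+a²b²≡a⁴+b⁴⇒solution : ∀ {m a b} → Coprime a b → 0 < a → 0 < b → a * b < m →
    m * m + a * a * (b * b) ≡ a * a * (a * a) + b * b * (b * b) → SolutionBelow m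
  m²+a²b²≡a⁴+b⁴⇒solution {m} {a} {b} coprime 0<a 0<b ab<m eq with 2 ∣? a | 2 ∣? b
  ... | yes 2∣a | yes 2∣b = ⊥-elim (coprime⇒¬common-prime coprime prime[2] 2∣a 2∣b)
  ... | no 2∤a | yes 2∣b = m²+a²b²≡a⁴+b⁴⇒solution-odd-even 2∤a 2∣b coprime 0<b ab<m eq
  ... | yes 2∣a | no 2∤b = m²+a²b²≡a⁴+b⁴⇒solution-odd-even 2∤b 2∣a (coprime-sym coprime) 0<a
                              (subst (_< m) (*-comm a b) ab<m) (m²+a²b²≡a⁴+b⁴-sym {m} {a} {b} eq)
  ... | no 2∤a | no 2∤b with m≡n+k⊎n≡m+1+k a b
  ...   | inj₁ (d , refl) = m²+a²b²≡a⁴+b⁴⇒solution-odd-odd 2∤a 2∤b coprime ab<m eq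
  ...   | inj₂ (d , refl) = m²+a²b²≡a⁴+b⁴⇒solution-odd-odd 2∤b 2∤a (coprime-sym coprime)
                              (subst (_< m) (*-comm a _) ab<m) (m²+a²b²≡a⁴+b⁴-sym {m} {a} {a + suc d} eq)

  smaller-solution : ∀ {m n} → Solution m n → SolutionBelow m
  smaller-solution {m} {n} sol with coprime⊎common-prime m n
  ... | inj₂ (p , pp , p∣m , p∣n) = common-prime⇒smaller-solution pp p∣m p∣n sol
  ... | inj₁ coprime with coprime-solution⇒quartic coprime sol
  ...   | a , b , coprime-ab , refl , eq =
    m²+a²b²≡a⁴+b⁴⇒solution coprime-ab (0<m*n⇒0<m n>0) (0<m*n⇒0<m (subst (0 <_) (*-comm a b) n>0)) (solution⇒n<m sol) eq
    where open Solution sol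

  no-solution : ∀ m n → ¬ Solution m n
  no-solution = <-rec (λ m → ∀ n → ¬ Solution m n) λ m rec n sol →
    let m′ , n′ , m′<m , sol′ = smaller-solution sol in rec m′<m n′ sol′

module Integral where

  open import Data.Integer.Base using (ℤ; +_; -[1+_]; ∣_∣; _+_; _*_; -_; _-_; NonZero)
  open import Data.Integer.Properties
    using (*-cancelˡ-≡; +-injective; pos-*; pos-+; i*j≡0⇒i≡0∨j≡0; i-j≡0⇒i≡j; ∣i∣≡0⇒i≡0; *-identityʳ; *-identityˡ)
  open import Data.Integer.Tactic.RingSolver using (solve)
  open import Data.List.Base using ([]; _∷_)
  import Data.Nat.Base as ℕ
  open ℕ using (suc)
  open import Data.Nat.Properties using (n≢0⇒n>0)
  open import Data.Product using (∃₂; _,_)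
  open import Data.Rational.Base as ℚ using (mkℚ; 0ℚ; 1ℚ; toℚᵘ)
  import Data.Rational.Properties as ℚ
  open import Data.Rational.Unnormalised.Base as ℚᵘ using (*≡*)
  import Data.Rational.Unnormalised.Properties as ℚᵘ
  open import Data.Sum using (inj₁; inj₂)
  open import Relation.Binary.PropositionalEquality
  open Descent using (Solution; solution)

  open ≡-Reasoning

  toℚᵘ-L²-L : ∀ L → toℚᵘ (L ℚ.* L ℚ.- L) ℚᵘ.≃ toℚᵘ L ℚᵘ.* toℚᵘ L ℚᵘ.- toℚᵘ L
  toℚᵘ-L²-L L =
    ℚᵘ.≃-trans (ℚ.toℚᵘ-homo-+ (L ℚ.* L) (ℚ.- L)) (ℚᵘ.+-cong (ℚ.toℚᵘ-homo-* L L) (ℚ.toℚᵘ-homo‿- L))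

  L²-L≡s²⇒cross-multiplied : ∀ L s → L ℚ.* L ℚ.- L ≡ s ℚ.* s →
          (ℚ.↥ L * ℚ.↥ L * ℚ.↧ L + - ℚ.↥ L * (ℚ.↧ L * ℚ.↧ L)) * (ℚ.↧ s * ℚ.↧ s)
            ≡ ℚ.↥ s * ℚ.↥ s * (ℚ.↧ L * ℚ.↧ L * ℚ.↧ L)
  L²-L≡s²⇒cross-multiplied L@record{} s@record{} h
    with ℚᵘ.≃-trans (ℚᵘ.≃-sym (toℚᵘ-L²-L L)) (ℚᵘ.≃-trans (ℚ.toℚᵘ-cong h) (ℚ.toℚᵘ-homo-* s s))
  ... | *≡* eq = eq

  toℚᵘ-L²-L+1 : ∀ L → toℚᵘ (L ℚ.* L ℚ.- L ℚ.+ 1ℚ) ℚᵘ.≃ toℚᵘ L ℚᵘ.* toℚᵘ L ℚᵘ.- toℚᵘ L ℚᵘ.+ toℚᵘ 1ℚ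
  toℚᵘ-L²-L+1 L =
    ℚᵘ.≃-trans (ℚ.toℚᵘ-homo-+ (L ℚ.* L ℚ.- L) 1ℚ) (ℚᵘ.+-cong (toℚᵘ-L²-L L) (ℚᵘ.≃-refl {toℚᵘ 1ℚ}))

  -- The factors + 1 come from toℚᵘ 1ℚ: arithmetic on ℚᵘ does not cancel.
  L²-L+1≡r²⇒cross-multiplied : ∀ L r → L ℚ.* L ℚ.- L ℚ.+ 1ℚ ≡ r ℚ.* r →
          ((ℚ.↥ L * ℚ.↥ L * ℚ.↧ L + - ℚ.↥ L * (ℚ.↧ L * ℚ.↧ L)) * + 1 + + 1 * (ℚ.↧ L * ℚ.↧ L * ℚ.↧ L)) * (ℚ.↧ r * ℚ.↧ r)
            ≡ ℚ.↥ r * ℚ.↥ r * (ℚ.↧ L * ℚ.↧ L * ℚ.↧ L * + 1)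
  L²-L+1≡r²⇒cross-multiplied L@record{} r@record{} h
    with ℚᵘ.≃-trans (ℚᵘ.≃-sym (toℚᵘ-L²-L+1 L)) (ℚᵘ.≃-trans (ℚ.toℚᵘ-cong h) (ℚ.toℚᵘ-homo-* r r))
  ... | *≡* eq = eq

  cross-multiplied⇒pythagorean : ∀ N D P E F .{{_ : NonZero D}} →
    (N * N * D + - N * (D * D)) * (E * E) ≡ P * P * (D * D * D) →
    (+ 2 * N - D) * E * F * ((+ 2 * N - D) * E * F) ≡ D * E * F * (D * E * F) + + 2 * P * D * F * (+ 2 * P * D * F)
  cross-multiplied⇒pythagorean N D P E F eq = *-cancelˡ-≡ D _ _ (begin
    D * ((+ 2 * N - D) * E * F * ((+ 2 * N - D) * E * F))
      ≡⟨ solve (N ∷ D ∷ E ∷ F ∷ []) ⟩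
    D * (D * E * F * (D * E * F)) + + 4 * (F * F) * ((N * N * D + - N * (D * D)) * (E * E))
      ≡⟨ cong (λ T → D * (D * E * F * (D * E * F)) + + 4 * (F * F) * T) eq ⟩
    D * (D * E * F * (D * E * F)) + + 4 * (F * F) * (P * P * (D * D * D))
      ≡⟨ solve (P ∷ D ∷ E ∷ F ∷ []) ⟩
    D * (D * E * F * (D * E * F) + + 2 * P * D * F * (+ 2 * P * D * F)) ∎)

  cross-multiplied⇒plus-three : ∀ N D R E F .{{_ : NonZero D}} →
    ((N * N * D + - N * (D * D)) * + 1 + + 1 * (D * D * D)) * (F * F) ≡ R * R * (D * D * D * + 1) →
    (+ 2 * N - D) * E * F * ((+ 2 * N - D) * E * F) + + 3 * (D * E * F * (D * E * F)) ≡ + 2 * R * D * E * (+ 2 * R * D * E)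
  cross-multiplied⇒plus-three N D R E F eq = *-cancelˡ-≡ D _ _ (begin
    D * ((+ 2 * N - D) * E * F * ((+ 2 * N - D) * E * F) + + 3 * (D * E * F * (D * E * F)))
      ≡⟨ solve (N ∷ D ∷ E ∷ F ∷ []) ⟩
    + 4 * (E * E) * (((N * N * D + - N * (D * D)) * + 1 + + 1 * (D * D * D)) * (F * F))
      ≡⟨ cong (+ 4 * (E * E) *_) eq ⟩
    + 4 * (E * E) * (R * R * (D * D * D * + 1))
      ≡⟨ solve (R ∷ D ∷ E ∷ []) ⟩
    D * (+ 2 * R * D * E * (+ 2 * R * D * E)) ∎)

  +∣i∣*∣i∣≡i*i : ∀ i → + (∣ i ∣ ℕ.* ∣ i ∣) ≡ i * i
  +∣i∣*∣i∣≡i*i (+ n) = pos-* n n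
  +∣i∣*∣i∣≡i*i -[1+ n ] = pos-* (suc n) (suc n)

  abs-pythagorean : ∀ x y z → x * x ≡ y * y + z * z →
                    ∣ x ∣ ℕ.* ∣ x ∣ ≡ ∣ y ∣ ℕ.* ∣ y ∣ ℕ.+ ∣ z ∣ ℕ.* ∣ z ∣
  abs-pythagorean x y z eq = +-injective (begin
    + (∣ x ∣ ℕ.* ∣ x ∣)                            ≡⟨ +∣i∣*∣i∣≡i*i x ⟩
    x * x                                          ≡⟨ eq ⟩
    y * y + z * z                                  ≡⟨ cong₂ _+_ (+∣i∣*∣i∣≡i*i y) (+∣i∣*∣i∣≡i*i z) ⟨
    + (∣ y ∣ ℕ.* ∣ y ∣) + + (∣ z ∣ ℕ.* ∣ z ∣)       ≡⟨ pos-+ (∣ y ∣ ℕ.* ∣ y ∣) (∣ z ∣ ℕ.* ∣ z ∣) ⟨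
    + (∣ y ∣ ℕ.* ∣ y ∣ ℕ.+ ∣ z ∣ ℕ.* ∣ z ∣)         ∎)

  abs-plus-three : ∀ x y z → x * x + + 3 * (y * y) ≡ z * z →
                   ∣ x ∣ ℕ.* ∣ x ∣ ℕ.+ 3 ℕ.* (∣ y ∣ ℕ.* ∣ y ∣) ≡ ∣ z ∣ ℕ.* ∣ z ∣
  abs-plus-three x y z eq = +-injective (begin
    + (∣ x ∣ ℕ.* ∣ x ∣ ℕ.+ 3 ℕ.* (∣ y ∣ ℕ.* ∣ y ∣))    ≡⟨ pos-+ (∣ x ∣ ℕ.* ∣ x ∣) (3 ℕ.* (∣ y ∣ ℕ.* ∣ y ∣)) ⟩
    + (∣ x ∣ ℕ.* ∣ x ∣) + + (3 ℕ.* (∣ y ∣ ℕ.* ∣ y ∣))  ≡⟨ cong (_+_ (+ (∣ x ∣ ℕ.* ∣ x ∣))) (pos-* 3 (∣ y ∣ ℕ.* ∣ y ∣)) ⟩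
    + (∣ x ∣ ℕ.* ∣ x ∣) + + 3 * + (∣ y ∣ ℕ.* ∣ y ∣)    ≡⟨ cong₂ (λ a b → a + + 3 * b) (+∣i∣*∣i∣≡i*i x) (+∣i∣*∣i∣≡i*i y) ⟩
    x * x + + 3 * (y * y)                            ≡⟨ eq ⟩
    z * z                                            ≡⟨ +∣i∣*∣i∣≡i*i z ⟨
    + (∣ z ∣ ℕ.* ∣ z ∣)                               ∎)

  N²D-ND²≡N[N-D]D : ∀ N D → N * N * D + - N * (D * D) ≡ N * (N - D) * D
  N²D-ND²≡N[N-D]D N D = solve (N ∷ D ∷ [])

  L²-L≡s²⇒↥s≢0 : ∀ {L s} → L ≢ 0ℚ → L ≢ 1ℚ → L ℚ.* L ℚ.- L ≡ s ℚ.* s → ℚ.↥ s ≢ + 0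
  L²-L≡s²⇒↥s≢0 {L@(mkℚ N d _)} {s@(mkℚ (+ 0) e _)} L≢0 L≢1 hs refl
    with i*j≡0⇒i≡0∨j≡0 (N * N * + suc d + - N * (+ suc d * + suc d)) (L²-L≡s²⇒cross-multiplied L s hs)
  ... | inj₂ ()
  ... | inj₁ numerator≡0 with i*j≡0⇒i≡0∨j≡0 (N * (N - + suc d)) (trans (sym (N²D-ND²≡N[N-D]D N (+ suc d))) numerator≡0)
  ...   | inj₂ ()
  ...   | inj₁ N[N-D]≡0 with i*j≡0⇒i≡0∨j≡0 N N[N-D]≡0
  ...     | inj₁ N≡0 = L≢0 (ℚ.↥p≡0⇒p≡0 L N≡0)
  ...     | inj₂ N-D≡0 =
    L≢1 (ℚ.≃⇒≡ (ℚ.*≡* (trans (*-identityʳ N) (trans (i-j≡0⇒i≡j N _ N-D≡0) (sym (*-identityˡ _))))))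

  rational-solution : ∀ {L r s} → L ≢ 0ℚ → L ≢ 1ℚ → L ℚ.* L ℚ.- L ℚ.+ 1ℚ ≡ r ℚ.* r → L ℚ.* L ℚ.- L ≡ s ℚ.* s →
                      ∃₂ Solution
  rational-solution {L@(mkℚ N d _)} {r@(mkℚ R f _)} {s@(mkℚ P e _)} L≢0 L≢1 hr hs =
    ∣ (+ 2 * N - D) * E * F ∣ , ∣ D * E * F ∣ ,
    solution ∣ + 2 * P * D * F ∣ ∣ + 2 * R * D * E ∣ ℕ.z<s
      (n≢0⇒n>0 λ ∣U∣≡0 → L²-L≡s²⇒↥s≢0 {L} {s} L≢0 L≢1 hs (2PDF≡0⇒P≡0 (∣i∣≡0⇒i≡0 ∣U∣≡0)))
      (abs-pythagorean ((+ 2 * N - D) * E * F) (D * E * F) (+ 2 * P * D * F)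
        (cross-multiplied⇒pythagorean N D P E F (L²-L≡s²⇒cross-multiplied L s hs)))
      (abs-plus-three ((+ 2 * N - D) * E * F) (D * E * F) (+ 2 * R * D * E)
        (cross-multiplied⇒plus-three N D R E F (L²-L+1≡r²⇒cross-multiplied L r hr)))
    where
    D = + suc d
    E = + suc e
    F = + suc f
    2PDF≡0⇒P≡0 : + 2 * P * D * F ≡ + 0 → P ≡ + 0
    2PDF≡0⇒P≡0 2PDF≡0 with i*j≡0⇒i≡0∨j≡0 (+ 2 * P * D) 2PDF≡0
    ... | inj₂ ()
    ... | inj₁ 2PD≡0 with i*j≡0⇒i≡0∨j≡0 (+ 2 * P) 2PD≡0
    ...   | inj₂ ()
    ...   | inj₁ 2P≡0 with i*j≡0⇒i≡0∨j≡0 (+ 2) 2P≡0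
    ...     | inj₁ ()
    ...     | inj₂ P≡0 = P≡0

open import Defs
open import Data.Rational using (ℚ; 0ℚ; 1ℚ; _+_; _-_; _*_)
open import Data.Product using (∃; _,_)
open import Relation.Binary.PropositionalEquality using (_≡_; _≢_)
open import Relation.Nullary using (¬_)
open Descent using (no-solution)
open Integral using (rational-solution)

lemma3p5 : (L : ℚ) → L ≢ 0ℚ → L ≢ 1ℚ → (∃ λ r → L * L - L + 1ℚ ≡ r * r) → ¬ (∃ λ s → L * L - L ≡ s * s)
lemma3p5 L L≢0 L≢1 (r , hr) (s , hs) =
  let m , n , sol = rational-solution {L} {r} {s} L≢0 L≢1 hr hs in no-solution m n sol
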